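{- Assume every literal on the trail $\tau$ has decision level at most $n$, and consider a clause-database state with parameter $n$ (as in the context) satisfying all four invariants. Let $\alpha\in D_a$ and $\beta\in D_b$ be distinct clauses, with $a,b\in\{0,1,\ldots,n,\infty\}$, such that $\alpha^{\le d}\subseteq\beta^{\le d}$ for some $d\in\mathbb{N}$, and let $k$ be the least such $d$. Suppose $b\ge k$. Form a new state as follows: if $a>b$, move $\alpha$ from $D_a$ to $D_b$; then remove $\beta$ from $D_b$ and either discard it or add it to $D_\infty$; all other groups are unchanged. Then the new state (with the same parameter $n$) satisfies all four invariants.
   Context: A clause is a finite set of pairwise distinct literals (read as their disjunction); a finite set of clauses is read as their conjunction (the empty set is true). Fix a CNF formula $I$ (the input clauses) and a trail $\tau=\langle \ell_1@d_1,\ldots,\ell_k@d_k\rangle$: a finite sequence of literals over pairwise distinct variables, each annotated with a decision level $d_j\in\mathbb{N}$, with $d_1\le\cdots\le d_k$ (and such that every literal that is not the first literal of its positive level is implied by $I$ together with the earlier first-literals-of-levels). For $d\in\mathbb{N}$, $\tau^{\le d}$ is the subsequence of literals with level $\le d$, viewed as a partial assignment. For a formula $\varphi$, $\tau^{\le d}\models\varphi$ means every total assignment extending $\tau^{\le d}$ satisfies $\varphi$. Write $\varphi\to^d\psi$ if $\tau^{\le d}\models(\varphi\to\psi)$ and $\varphi\leftrightarrow^d\psi$ if $\tau^{\le d}\models(\varphi\leftrightarrow\psi)$. For a clause $\alpha$, $\alpha^{\le d}=\{\ell\in\alpha : \neg\ell\notin\tau^{\le d}\}$ (remove literals falsified at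 level $\le d$). A clause-database state with parameter $n$ consists of pairwise disjoint finite sets of clauses: active groups $D_0,D_1,\ldots,D_n,D_\infty$ and stashed groups $S_k^q$ for $1\le k\le n$, $0\le q<k$. Notation: $S_k=\bigcup_{q<k}S_k^q$; $S=\bigcup_{k=1}^n S_k$; $S^i=\bigcup_{k} S_k^i$; $P=D_0\cup S^0$; $D=D_1\cup\cdots\cup D_n$; $N=D_0\cup D$; $A=N\cup D_\infty$. Invariants: (Input-equivalence) $I\leftrightarrow^0 P$. (Correctness) $N\leftrightarrow^n P$. (Representation) for every $i$ with $1\le i\le n$ and every $\alpha\in S_i$, at least one of: (a) there are $r$ with $0\le r\le i$ and $\beta\in D_r$ with $\beta\to^i\alpha$; (b) there are $r\le i$, $j$ with $i<j\le n$, and $\beta\in S_j^r$ with $\beta\to^i\alpha$; (c) $\tau^{\le i}\models\alpha$. (Closure) for every $\gamma\in A\cup S$, $P\to^0\gamma$. -}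

module Defs where

open import Data.Nat using (ℕ; zero; suc; _≤_; _<_; _<ᵇ_)
import Data.Nat as ℕ
open import Data.Bool using (Bool; true; false; if_then_else_)
open import Data.Product using (Σ; Σ-syntax; _×_; _,_; proj₁; proj₂)
open import Data.Sum using (_⊎_)
open import Data.List using (List; []; _∷_; _++_; map; filter)
open import Data.List.Properties using (≡-dec)
open import Data.List.Membership.Propositional using (_∈_)
open import Data.List.Relation.Unary.Any using (Any)
open import Data.List.Relation.Unary.All using (All)
open import Data.List.Relation.Unary.Linked using (Linked)
open import Data.List.Relation.Unary.Unique.Propositional using (Unique)
open import Relation.Nullary using (¬_; Dec; yes; no; ¬?)

open import Relation.Binary.PropositionalEquality using (_≡_; _≢_; refl; cong; cong₂)
open import Relation.Binary.Definitions using (DecidableEquality)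
open import Function using (_∘_; id)
open import Data.Unit using (⊤)
open import Data.Empty using (⊥)

data Lit : Set where
  pos : ℕ → Lit
  neg : ℕ → Lit

var : Lit → ℕ
var (pos x) = x
var (neg x) = x

¬L : Lit → Lit
¬L (pos x) = neg x
¬L (neg x) = pos x

_≟L_ : DecidableEquality Lit
pos x ≟L pos y with x ℕ.≟ y
... | yes refl = yes refl
... | no x≢y = no λ { refl → x≢y refl }
pos x ≟L neg y = no λ ()
neg x ≟L pos y = no λ ()
neg x ≟L neg y with x ℕ.≟ y
... | yes refl = yes refl
... | no x≢y = no λ { refl → x≢y refl }

-- a clause is a finite list of literals; being a clause in the paper's
-- sense (pairwise distinct literals) is the predicate IsClause
Clause : Set
Clause = List Lit

IsClause : Clause → Set
IsClause = Unique

_≟C_ : DecidableEquality Clause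
_≟C_ = ≡-dec _≟L_

Assign : Set
Assign = ℕ → Bool

SatL : Assign → Lit → Set
SatL σ (pos x) = σ x ≡ true
SatL σ (neg x) = σ x ≡ false

SatC : Assign → Clause → Set
SatC σ γ = Any (SatL σ) γ

ClauseSet : Set₁
ClauseSet = Clause → Set

SatS : Assign → ClauseSet → Set
SatS σ X = ∀ γ → X γ → SatC σ γ

SatF : Assign → List Clause → Set
SatF σ F = ∀ γ → γ ∈ F → SatC σ γ

Form : Set₁
Form = Assign → Set

⟦_⟧S : ClauseSet → Form
⟦ X ⟧S σ = SatS σ X

⟦_⟧C : Clause → Form
⟦ γ ⟧C σ = SatC σ γ

⟦_⟧F : List Clause → Form
⟦ F ⟧F σ = SatF σ F

-- a trail is a list of literals annotated with decision levels
Trail : Set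
Trail = List (Lit × ℕ)

-- the trail element x = ℓ@d is the first literal of its (positive) level,
-- given the part `pre` of the trail preceding it
IsDecision : Trail → Lit × ℕ → Set
IsDecision pre (ℓ , d) = (0 < d) × All (λ y → proj₂ y ≢ d) pre

ImpliedBy : List Clause → Trail → Lit → Set
ImpliedBy I pre ℓ =
  ∀ (σ : Assign) → SatF σ I →
  (∀ p₁ x p₂ → pre ≡ p₁ ++ x ∷ p₂ → IsDecision p₁ x → SatL σ (proj₁ x)) →
  SatL σ ℓ

record WFTrail (I : List Clause) (τ : Trail) : Set where
  field
    distinctVars : Unique (map (var ∘ proj₁) τ)
    levelsMono   : Linked _≤_ (map proj₂ τ)
    implied      : ∀ pre x post → τ ≡ pre ++ x ∷ post →
                   ¬ IsDecision pre x → ImpliedBy I pre (proj₁ x)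

module _ (τ : Trail) where

  InTr≤ : ℕ → Lit → Set
  InTr≤ d ℓ = Σ[ e ∈ ℕ ] ((ℓ , e) ∈ τ × e ≤ d)

  Extends : ℕ → Assign → Set
  Extends d σ = ∀ ℓ → InTr≤ d ℓ → SatL σ ℓ

  Models : ℕ → Form → Set
  Models d φ = ∀ σ → Extends d σ → φ σ

  Imp : ℕ → Form → Form → Set
  Imp d φ ψ = Models d (λ σ → φ σ → ψ σ)

  Iff : ℕ → Form → Form → Set
  Iff d φ ψ = Models d (λ σ → (φ σ → ψ σ) × (ψ σ → φ σ))

  InRestr : ℕ → Clause → Lit → Set
  InRestr d α ℓ = ℓ ∈ α × ¬ InTr≤ d (¬L ℓ)

  RestrSub : ℕ → Clause → Clause → Set
  RestrSub d α β = ∀ ℓ → InRestr d α ℓ → InRestr d β ℓ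

data Lvl : Set where
  fin : ℕ → Lvl
  ∞   : Lvl

-- names of groups: D x (active) and S k q (stashed S_k^q)
data Grp : Set where
  D : Lvl → Grp
  S : ℕ → ℕ → Grp

_≟Lvl_ : DecidableEquality Lvl
fin i ≟Lvl fin j with i ℕ.≟ j
... | yes refl = yes refl
... | no i≢j = no λ { refl → i≢j refl }
fin i ≟Lvl ∞ = no λ ()
∞ ≟Lvl fin j = no λ ()
∞ ≟Lvl ∞ = yes refl

_≟G_ : DecidableEquality Grp
D x ≟G D y with x ≟Lvl y
... | yes refl = yes refl
... | no x≢y = no λ { refl → x≢y refl }
D x ≟G S k q = no λ ()
S k q ≟G D x = no λ ()
S k q ≟G S k' q' with k ℕ.≟ k' | q ℕ.≟ q'
... | yes refl | yes refl = yes refl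
... | no k≢k' | _ = no λ { refl → k≢k' refl }
... | _ | no q≢q' = no λ { refl → q≢q' refl }

ValidLvl : ℕ → Lvl → Set
ValidLvl n (fin i) = i ≤ n
ValidLvl n ∞ = ⊤

ValidGrp : ℕ → Grp → Set
ValidGrp n (D x) = ValidLvl n x
ValidGrp n (S k q) = (1 ≤ k) × (k ≤ n) × (q < k)

-- a database assigns a finite set (list) of clauses to every group name;
-- only the valid group names (ValidGrp n) are part of the state
DB : Set
DB = Grp → List Clause

record IsState (n : ℕ) (db : DB) : Set where
  field
    clauses  : ∀ g γ → ValidGrp n g → γ ∈ db g → IsClause γ
    disjoint : ∀ g h → ValidGrp n g → ValidGrp n h → g ≢ h →
               ∀ γ → γ ∈ db g → γ ∈ db h → ⊥

module _ (n : ℕ) (db : DB) where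

  InSk : ℕ → Clause → Set
  InSk k γ = Σ[ q ∈ ℕ ] (q < k × γ ∈ db (S k q))

  InS : Clause → Set
  InS γ = Σ[ k ∈ ℕ ] (1 ≤ k × k ≤ n × InSk k γ)

  InSup : ℕ → Clause → Set
  InSup i γ = Σ[ k ∈ ℕ ] (1 ≤ k × k ≤ n × i < k × γ ∈ db (S k i))

  InP : Clause → Set
  InP γ = γ ∈ db (D (fin 0)) ⊎ InSup 0 γ

  InD : Clause → Set
  InD γ = Σ[ i ∈ ℕ ] (1 ≤ i × i ≤ n × γ ∈ db (D (fin i)))

  InN : Clause → Set
  InN γ = γ ∈ db (D (fin 0)) ⊎ InD γ

  InA : Clause → Set
  InA γ = InN γ ⊎ γ ∈ db (D ∞)

  module _ (τ : Trail) (I : List Clause) where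

    InputEquivalence : Set
    InputEquivalence = Iff τ 0 ⟦ I ⟧F ⟦ InP ⟧S

    Correctness : Set
    Correctness = Iff τ n ⟦ InN ⟧S ⟦ InP ⟧S

    Representation : Set
    Representation =
      ∀ i → 1 ≤ i → i ≤ n → ∀ α → InSk i α →
        (Σ[ r ∈ ℕ ] Σ[ β ∈ Clause ]
           (r ≤ i × β ∈ db (D (fin r)) × Imp τ i ⟦ β ⟧C ⟦ α ⟧C))
      ⊎ (Σ[ r ∈ ℕ ] Σ[ j ∈ ℕ ] Σ[ β ∈ Clause ]
           (r ≤ i × i < j × j ≤ n × β ∈ db (S j r) × Imp τ i ⟦ β ⟧C ⟦ α ⟧C))
      ⊎ Models τ i ⟦ α ⟧C

    Closure : Set
    Closure = ∀ γ → InA γ ⊎ InS γ → Imp τ 0 ⟦ InP ⟧S ⟦ γ ⟧C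

    record Invariants : Set where
      field
        input-equivalence : InputEquivalence
        correctness       : Correctness
        representation    : Representation
        closure           : Closure

removeFrom : Grp → Clause → DB → DB
removeFrom g c db h with h ≟G g
... | yes _ = filter (λ γ → ¬? (γ ≟C c)) (db h)
... | no _ = db h

addTo : Grp → Clause → DB → DB
addTo g c db h with h ≟G g
... | yes _ = c ∷ db h
... | no _ = db h

_>ᵇ_ : Lvl → Lvl → Bool
fin i >ᵇ fin j = j <ᵇ i
fin i >ᵇ ∞ = false
∞ >ᵇ fin j = true
∞ >ᵇ ∞ = false

_≤L_ : ℕ → Lvl → Set
k ≤L fin j = k ≤ j
k ≤L ∞ = ⊤

subsume : (a b : Lvl) (α β : Clause) (keep : Bool) → DB → DB
subsume a b α β keep db =
  let db₁ = if a >ᵇ b then addTo (D b) α (removeFrom (D a) α db) else db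
      db₂ = removeFrom (D b) β db₁
  in if keep then addTo (D ∞) β db₂ else db₂

-- A subsumption step only rearranges active clauses: the stashed groups are
-- untouched, every clause of the new state already lies in A ∪ S of the old
-- one, and every clause removed from a group D_r is implied at level r by α,
-- which now sits in D_{min(a,b)} with min(a,b) ≤ r (for β this is
-- α^{≤k} ⊆ β^{≤k} together with k ≤ b).  By the old Closure the first two
-- facts give P →⁰ P'; the third gives P' →⁰ P, N' →ⁿ N and Representation.
module Submission where

open import Defs
open import Data.Nat using (ℕ; suc; _≤_; z≤n; s≤s; _<ᵇ_)
open import Data.Nat.Properties using (≤-refl; ≤-trans; <⇒≤; ≮⇒≥; <ᵇ-reflects-<)
open import Data.Bool using (Bool; true; false; if_then_else_)
open import Data.Product using (Σ-syntax; _×_; _,_; proj₁; proj₂)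
open import Data.Sum using (_⊎_; inj₁; inj₂)
open import Data.List using (List)
open import Data.List.Membership.Propositional using (_∈_; find; lose)
open import Data.List.Membership.Propositional.Properties using (∈-filter⁻; ∈-filter⁺)
open import Data.List.Relation.Unary.All using (All)
open import Data.List.Relation.Unary.Any using (here; there)
open import Data.Unit using (tt)
open import Relation.Nullary using (¬_; yes; no; ¬?; contradiction)
open import Relation.Nullary.Reflects using (ofʸ; ofⁿ)
open import Relation.Binary.PropositionalEquality using (_≡_; _≢_; refl; sym; trans; subst)

module _ {τ : Trail} where

  Extends-antimono : ∀ {d e σ} → d ≤ e → Extends τ e σ → Extends τ d σ
  Extends-antimono d≤e ext ℓ (f , ℓf∈τ , f≤d) = ext ℓ (f , ℓf∈τ , ≤-trans f≤d d≤e)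

  Models-mono : ∀ {d e φ} → d ≤ e → Models τ d φ → Models τ e φ
  Models-mono d≤e ⊨φ σ ext = ⊨φ σ (Extends-antimono d≤e ext)

  Imp-refl : ∀ {d φ} → Imp τ d φ φ
  Imp-refl σ _ φσ = φσ

  Imp-trans : ∀ {d φ ψ χ} → Imp τ d φ ψ → Imp τ d ψ χ → Imp τ d φ χ
  Imp-trans φ⇒ψ ψ⇒χ σ ext φσ = ψ⇒χ σ ext (φ⇒ψ σ ext φσ)

  Iff-intro : ∀ {d φ ψ} → Imp τ d φ ψ → Imp τ d ψ φ → Iff τ d φ ψ
  Iff-intro φ⇒ψ ψ⇒φ σ ext = φ⇒ψ σ ext , ψ⇒φ σ ext

  Iff⇒Imp : ∀ {d φ ψ} → Iff τ d φ ψ → Imp τ d φ ψ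
  Iff⇒Imp φ⇔ψ σ ext = proj₁ (φ⇔ψ σ ext)

  Iff⇒Imp⁻ : ∀ {d φ ψ} → Iff τ d φ ψ → Imp τ d ψ φ
  Iff⇒Imp⁻ φ⇔ψ σ ext = proj₂ (φ⇔ψ σ ext)

  SatL-¬L : ∀ σ ℓ → SatL σ ℓ → ¬ SatL σ (¬L ℓ)
  SatL-¬L σ (pos x) σx≡true σx≡false = contradiction (trans (sym σx≡true) σx≡false) λ ()
  SatL-¬L σ (neg x) σx≡false σx≡true = contradiction (trans (sym σx≡true) σx≡false) λ ()

  -- A literal satisfied by an extension of τ^{≤k} is not falsified by τ^{≤k}.
  RestrSub⇒Imp : ∀ {k α β} → RestrSub τ k α β → Imp τ k ⟦ α ⟧C ⟦ β ⟧C
  RestrSub⇒Imp α⊆β σ ext σ⊨α with find σ⊨α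
  ... | ℓ , ℓ∈α , σ⊨ℓ =
    lose (proj₁ (α⊆β ℓ (ℓ∈α , λ ¬ℓ∈τ → SatL-¬L σ ℓ σ⊨ℓ (ext (¬L ℓ) ¬ℓ∈τ)))) σ⊨ℓ

data _≼_ : Lvl → Lvl → Set where
  fin≼fin : ∀ {i j} → i ≤ j → fin i ≼ fin j
  ≼∞      : ∀ {x} → x ≼ ∞

-- min(a, b): the step leaves α in D (lower a b)
lower : Lvl → Lvl → Lvl
lower a b = if a >ᵇ b then b else a

lower-≼ˡ : ∀ a b → lower a b ≼ a
lower-≼ˡ (fin i) (fin j) with j <ᵇ i | <ᵇ-reflects-< j i
... | true  | ofʸ j<i = fin≼fin (<⇒≤ j<i)
... | false | _       = fin≼fin ≤-refl
lower-≼ˡ (fin i) ∞ = fin≼fin ≤-refl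
lower-≼ˡ ∞       _ = ≼∞

lower-≼ʳ : ∀ a b → lower a b ≼ b
lower-≼ʳ (fin i) (fin j) with j <ᵇ i | <ᵇ-reflects-< j i
... | true  | _       = fin≼fin ≤-refl
... | false | ofⁿ j≮i = fin≼fin (≮⇒≥ j≮i)
lower-≼ʳ (fin i) ∞       = ≼∞
lower-≼ʳ ∞       (fin j) = fin≼fin ≤-refl
lower-≼ʳ ∞       ∞       = ≼∞

module _ (n : ℕ) (db : DB) where

  InN-fin : ∀ {i γ} → i ≤ n → γ ∈ db (D (fin i)) → InN n db γ
  InN-fin {0}     _   γ∈D₀ = inj₁ γ∈D₀
  InN-fin {suc i} i≤n γ∈Dᵢ = inj₂ (suc i , s≤s z≤n , i≤n , γ∈Dᵢ)

  InN⇒fin : ∀ {γ} → InN n db γ → Σ[ i ∈ ℕ ] (i ≤ n × γ ∈ db (D (fin i)))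
  InN⇒fin (inj₁ γ∈D₀)               = 0 , z≤n , γ∈D₀
  InN⇒fin (inj₂ (i , _ , i≤n , γ∈Dᵢ)) = i , i≤n , γ∈Dᵢ

  InA-valid : ∀ {x γ} → ValidLvl n x → γ ∈ db (D x) → InA n db γ
  InA-valid {fin i} i≤n γ∈Dᵢ = inj₁ (InN-fin i≤n γ∈Dᵢ)
  InA-valid {∞}     _   γ∈D∞ = inj₂ γ∈D∞

  InP⇒InA∪InS : ∀ {γ} → InP n db γ → InA n db γ ⊎ InS n db γ
  InP⇒InA∪InS (inj₁ γ∈D₀)                   = inj₁ (inj₁ (inj₁ γ∈D₀))
  InP⇒InA∪InS (inj₂ (k , 1≤k , k≤n , 0<k , γ∈S)) = inj₂ (k , 1≤k , k≤n , 0 , 0<k , γ∈S)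

-- Alternative (a) of Representation.
ImpliedFromBelow : Trail → DB → ℕ → Clause → Set
ImpliedFromBelow τ db r γ =
  Σ[ j ∈ ℕ ] Σ[ δ ∈ Clause ] (j ≤ r × δ ∈ db (D (fin j)) × Imp τ r ⟦ δ ⟧C ⟦ γ ⟧C)

module _ {τ : Trail} (db : DB) where

  ImpliedFromBelow-trans : ∀ {r i δ γ} → r ≤ i → ImpliedFromBelow τ db r δ →
                           Imp τ i ⟦ δ ⟧C ⟦ γ ⟧C → ImpliedFromBelow τ db i γ
  ImpliedFromBelow-trans r≤i (j , ε , j≤r , ε∈Dⱼ , ε⇒δ) δ⇒γ =
    j , ε , ≤-trans j≤r r≤i , ε∈Dⱼ , Imp-trans (Models-mono r≤i ε⇒δ) δ⇒γ

  ImpliedFromBelow⇒Imp-N : ∀ {n r γ} → r ≤ n → ImpliedFromBelow τ db r γ →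
                           Imp τ n ⟦ InN n db ⟧S ⟦ γ ⟧C
  ImpliedFromBelow⇒Imp-N {n} r≤n (j , δ , j≤r , δ∈Dⱼ , δ⇒γ) σ ext σ⊨N =
    Models-mono r≤n δ⇒γ σ ext (σ⊨N δ (InN-fin n db (≤-trans j≤r r≤n) δ∈Dⱼ))

  ImpliedFromBelow-≼ : ∀ {x r δ γ} → x ≼ fin r → δ ∈ db (D x) →
                       Imp τ r ⟦ δ ⟧C ⟦ γ ⟧C → ImpliedFromBelow τ db r γ
  ImpliedFromBelow-≼ (fin≼fin j≤r) δ∈Dⱼ δ⇒γ = _ , _ , j≤r , δ∈Dⱼ , δ⇒γ

record ActiveRewrite (τ : Trail) (n : ℕ) (db db′ : DB) : Set where
  field
    stash-unchanged : ∀ k q → db′ (S k q) ≡ db (S k q)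
    active-from-A   : ∀ x γ → ValidLvl n x → γ ∈ db′ (D x) → InA n db γ
    active-implied  : ∀ r γ → γ ∈ db (D (fin r)) → ImpliedFromBelow τ db′ r γ

module _ {τ : Trail} {I : List Clause} {n : ℕ} {db db′ : DB}
         (rw : ActiveRewrite τ n db db′) (inv : Invariants n db τ I) where

  open ActiveRewrite rw
  open Invariants inv

  private
    ∈-stash⁻ : ∀ {k q γ} → γ ∈ db′ (S k q) → γ ∈ db (S k q)
    ∈-stash⁻ {k} {q} = subst (_ ∈_) (stash-unchanged k q)

    ∈-stash⁺ : ∀ {k q γ} → γ ∈ db (S k q) → γ ∈ db′ (S k q)
    ∈-stash⁺ {k} {q} = subst (_ ∈_) (sym (stash-unchanged k q))

    A∪S-old : ∀ γ → InA n db′ γ ⊎ InS n db′ γ → InA n db γ ⊎ InS n db γ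
    A∪S-old γ (inj₁ (inj₁ (inj₁ γ∈D₀))) = inj₁ (active-from-A (fin 0) γ z≤n γ∈D₀)
    A∪S-old γ (inj₁ (inj₁ (inj₂ (i , _ , i≤n , γ∈Dᵢ)))) = inj₁ (active-from-A (fin i) γ i≤n γ∈Dᵢ)
    A∪S-old γ (inj₁ (inj₂ γ∈D∞)) = inj₁ (active-from-A ∞ γ tt γ∈D∞)
    A∪S-old γ (inj₂ (k , 1≤k , k≤n , q , q<k , γ∈S)) = inj₂ (k , 1≤k , k≤n , q , q<k , ∈-stash⁻ γ∈S)

    P⇒P′ : Imp τ 0 ⟦ InP n db ⟧S ⟦ InP n db′ ⟧S
    P⇒P′ σ ext σ⊨P γ γ∈P′ = closure γ (A∪S-old γ (InP⇒InA∪InS n db′ γ∈P′)) σ ext σ⊨P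

    P′⇒P : Imp τ 0 ⟦ InP n db′ ⟧S ⟦ InP n db ⟧S
    P′⇒P σ ext σ⊨P′ γ (inj₁ γ∈D₀) with active-implied 0 γ γ∈D₀
    ... | .0 , δ , z≤n , δ∈D₀ , δ⇒γ = δ⇒γ σ ext (σ⊨P′ δ (inj₁ δ∈D₀))
    P′⇒P σ ext σ⊨P′ γ (inj₂ (k , 1≤k , k≤n , 0<k , γ∈S)) =
      σ⊨P′ γ (inj₂ (k , 1≤k , k≤n , 0<k , ∈-stash⁺ γ∈S))

    N⇒N′ : Imp τ n ⟦ InN n db ⟧S ⟦ InN n db′ ⟧S
    N⇒N′ σ ext σ⊨N γ γ∈N′ =
      closure γ (A∪S-old γ (inj₁ (inj₁ γ∈N′))) σ (Extends-antimono z≤n ext)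
        (Iff⇒Imp correctness σ ext σ⊨N)

    N′⇒N : Imp τ n ⟦ InN n db′ ⟧S ⟦ InN n db ⟧S
    N′⇒N σ ext σ⊨N′ γ γ∈N with InN⇒fin n db γ∈N
    ... | r , r≤n , γ∈Dᵣ = ImpliedFromBelow⇒Imp-N db′ r≤n (active-implied r γ γ∈Dᵣ) σ ext σ⊨N′

    representation′ : Representation n db′ τ I
    representation′ i 1≤i i≤n γ (q , q<i , γ∈S) with representation i 1≤i i≤n γ (q , q<i , ∈-stash⁻ γ∈S)
    ... | inj₁ (r , δ , r≤i , δ∈Dᵣ , δ⇒γ) =
      inj₁ (ImpliedFromBelow-trans db′ r≤i (active-implied r δ δ∈Dᵣ) δ⇒γ)
    ... | inj₂ (inj₁ (r , j , δ , r≤i , i<j , j≤n , δ∈S , δ⇒γ)) =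
      inj₂ (inj₁ (r , j , δ , r≤i , i<j , j≤n , ∈-stash⁺ δ∈S , δ⇒γ))
    ... | inj₂ (inj₂ ⊨γ) = inj₂ (inj₂ ⊨γ)

  ActiveRewrite-preserves-Invariants : Invariants n db′ τ I
  ActiveRewrite-preserves-Invariants = record
    { input-equivalence = Iff-intro
        (Imp-trans (Iff⇒Imp input-equivalence) P⇒P′)
        (Imp-trans P′⇒P (Iff⇒Imp⁻ input-equivalence))
    ; correctness = Iff-intro
        (Imp-trans N′⇒N (Imp-trans (Iff⇒Imp correctness) (Models-mono z≤n P⇒P′)))
        (Imp-trans (Models-mono z≤n P′⇒P) (Imp-trans (Iff⇒Imp⁻ correctness) N⇒N′))
    ; representation = representation′
    ; closure = λ γ γ∈A∪S → Imp-trans P′⇒P (closure γ (A∪S-old γ γ∈A∪S))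
    }

module _ (g : Grp) (c : Clause) (db : DB) {h : Grp} {γ : Clause} where

  ∈-removeFrom⁻ : γ ∈ removeFrom g c db h → γ ∈ db h
  ∈-removeFrom⁻ γ∈ with h ≟G g
  ... | yes _ = proj₁ (∈-filter⁻ (λ δ → ¬? (δ ≟C c)) γ∈)
  ... | no  _ = γ∈

  ∈-removeFrom⁺ : γ ∈ db h → γ ∈ removeFrom g c db h ⊎ (h ≡ g × γ ≡ c)
  ∈-removeFrom⁺ γ∈ with h ≟G g | γ ≟C c
  ... | yes h≡g | yes γ≡c = inj₂ (h≡g , γ≡c)
  ... | yes _   | no  γ≢c = inj₁ (∈-filter⁺ (λ δ → ¬? (δ ≟C c)) γ∈ γ≢c)
  ... | no  _   | _       = inj₁ γ∈

  ∈-addTo⁻ : γ ∈ addTo g c db h → γ ∈ db h ⊎ γ ≡ c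
  ∈-addTo⁻ γ∈ with h ≟G g
  ∈-addTo⁻ (here γ≡c) | yes _ = inj₂ γ≡c
  ∈-addTo⁻ (there γ∈) | yes _ = inj₁ γ∈
  ... | no _ = inj₁ γ∈

  ∈-addTo⁺ : γ ∈ db h → γ ∈ addTo g c db h
  ∈-addTo⁺ γ∈ with h ≟G g
  ... | yes _ = there γ∈
  ... | no  _ = γ∈

∈-addTo-self : ∀ g c db → c ∈ addTo g c db g
∈-addTo-self g c db with g ≟G g
... | yes _   = here refl
... | no  g≢g = contradiction refl g≢g

-- subsume a b α β keep db is definitionally
-- addIf keep ∞ β (removeFrom (D b) β (moveIf (a >ᵇ b) a b α db)).
moveIf : Bool → Lvl → Lvl → Clause → DB → DB
moveIf t a b α db = if t then addTo (D b) α (removeFrom (D a) α db) else db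

addIf : Bool → Lvl → Clause → DB → DB
addIf t x β db = if t then addTo (D x) β db else db

module _ (a b : Lvl) (α : Clause) (db : DB) where

  moveIf-stash : ∀ t k q → moveIf t a b α db (S k q) ≡ db (S k q)
  moveIf-stash true  _ _ = refl
  moveIf-stash false _ _ = refl

  ∈-moveIf⁻ : ∀ t {h γ} → γ ∈ moveIf t a b α db h → γ ∈ db h ⊎ γ ≡ α
  ∈-moveIf⁻ true {h} γ∈ with ∈-addTo⁻ (D b) α (removeFrom (D a) α db) {h} γ∈
  ... | inj₁ γ∈′ = inj₁ (∈-removeFrom⁻ (D a) α db γ∈′)
  ... | inj₂ γ≡α = inj₂ γ≡α
  ∈-moveIf⁻ false γ∈ = inj₁ γ∈

  ∈-moveIf⁺ : ∀ t {h γ} → γ ∈ db h → γ ∈ moveIf t a b α db h ⊎ (h ≡ D a × γ ≡ α)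
  ∈-moveIf⁺ true {h} γ∈ with ∈-removeFrom⁺ (D a) α db {h} γ∈
  ... | inj₁ γ∈′  = inj₁ (∈-addTo⁺ (D b) α (removeFrom (D a) α db) {h} γ∈′)
  ... | inj₂ moved = inj₂ moved
  ∈-moveIf⁺ false γ∈ = inj₁ γ∈

  α∈moveIf : α ∈ db (D a) → α ∈ moveIf (a >ᵇ b) a b α db (D (lower a b))
  α∈moveIf α∈Dₐ with a >ᵇ b
  ... | true  = ∈-addTo-self (D b) α (removeFrom (D a) α db)
  ... | false = α∈Dₐ

module _ (x : Lvl) (β : Clause) (db : DB) where

  addIf-stash : ∀ t k q → addIf t x β db (S k q) ≡ db (S k q)
  addIf-stash true  _ _ = refl
  addIf-stash false _ _ = refl

  ∈-addIf⁻ : ∀ t {h γ} → γ ∈ addIf t x β db h → γ ∈ db h ⊎ γ ≡ β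
  ∈-addIf⁻ true  = ∈-addTo⁻ (D x) β db
  ∈-addIf⁻ false = inj₁

  ∈-addIf⁺ : ∀ t {h γ} → γ ∈ db h → γ ∈ addIf t x β db h
  ∈-addIf⁺ true  = ∈-addTo⁺ (D x) β db
  ∈-addIf⁺ false γ∈ = γ∈

module _ (a b : Lvl) (α β : Clause) (keep : Bool) (db : DB) where

  private
    moved : DB
    moved = moveIf (a >ᵇ b) a b α db

  subsume-stash : ∀ k q → subsume a b α β keep db (S k q) ≡ db (S k q)
  subsume-stash k q =
    trans (addIf-stash ∞ β (removeFrom (D b) β moved) keep k q)
          (moveIf-stash a b α db (a >ᵇ b) k q)

  ∈-subsume⁻ : ∀ {h γ} → γ ∈ subsume a b α β keep db h → γ ∈ db h ⊎ γ ≡ α ⊎ γ ≡ β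
  ∈-subsume⁻ {h} γ∈ with ∈-addIf⁻ ∞ β (removeFrom (D b) β moved) keep {h} γ∈
  ... | inj₂ γ≡β = inj₂ (inj₂ γ≡β)
  ... | inj₁ γ∈′ with ∈-moveIf⁻ a b α db (a >ᵇ b) (∈-removeFrom⁻ (D b) β moved {h} γ∈′)
  ...   | inj₁ γ∈″ = inj₁ γ∈″
  ...   | inj₂ γ≡α = inj₂ (inj₁ γ≡α)

  ∈-subsume⁺ : ∀ {h γ} → γ ∈ db h →
               γ ∈ subsume a b α β keep db h ⊎ (h ≡ D b × γ ≡ β) ⊎ (h ≡ D a × γ ≡ α)
  ∈-subsume⁺ {h} γ∈ with ∈-moveIf⁺ a b α db (a >ᵇ b) γ∈
  ... | inj₂ movedα = inj₂ (inj₂ movedα)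
  ... | inj₁ γ∈′ with ∈-removeFrom⁺ (D b) β moved {h} γ∈′
  ...   | inj₁ γ∈″   = inj₁ (∈-addIf⁺ ∞ β (removeFrom (D b) β moved) keep {h} γ∈″)
  ...   | inj₂ removed = inj₂ (inj₁ removed)

  α∈subsume : α ≢ β → α ∈ db (D a) → α ∈ subsume a b α β keep db (D (lower a b))
  α∈subsume α≢β α∈Dₐ with ∈-removeFrom⁺ (D b) β moved (α∈moveIf a b α db α∈Dₐ)
  ... | inj₁ α∈′     = ∈-addIf⁺ ∞ β (removeFrom (D b) β moved) keep α∈′
  ... | inj₂ (_ , α≡β) = contradiction α≡β α≢β

subsume-implied : ∀ {τ} (a b : Lvl) {α β} keep db → α ≢ β → α ∈ db (D a) →
                  ∀ {k} → RestrSub τ k α β → k ≤L b →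
                  ∀ r γ → γ ∈ db (D (fin r)) →
                  ImpliedFromBelow τ (subsume a b α β keep db) r γ
subsume-implied a b keep db α≢β α∈Dₐ α⊆β k≤b r γ γ∈Dᵣ with ∈-subsume⁺ a b _ _ keep db γ∈Dᵣ
... | inj₁ γ∈Dᵣ′ = r , γ , ≤-refl , γ∈Dᵣ′ , Imp-refl
... | inj₂ (inj₁ (refl , refl)) =
  ImpliedFromBelow-≼ (subsume a (fin r) _ _ keep db) (lower-≼ʳ a (fin r)) (α∈subsume a (fin r) _ _ keep db α≢β α∈Dₐ)
    (Models-mono k≤b (RestrSub⇒Imp α⊆β))
... | inj₂ (inj₂ (refl , refl)) =
  ImpliedFromBelow-≼ (subsume (fin r) b _ _ keep db) (lower-≼ˡ (fin r) b) (α∈subsume (fin r) b _ _ keep db α≢β α∈Dₐ) Imp-refl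

subsume-ActiveRewrite : ∀ {τ n db} {a b : Lvl} → ValidLvl n a → ValidLvl n b →
                        ∀ {α β} → α ∈ db (D a) → β ∈ db (D b) → α ≢ β →
                        ∀ {k} → RestrSub τ k α β → k ≤L b → ∀ keep →
                        ActiveRewrite τ n db (subsume a b α β keep db)
subsume-ActiveRewrite {n = n} {db} {a} {b} a-valid b-valid {α} {β} α∈Dₐ β∈Dᵦ α≢β α⊆β k≤b keep = record
  { stash-unchanged = subsume-stash a b α β keep db
  ; active-from-A   = from-A
  ; active-implied  = subsume-implied a b keep db α≢β α∈Dₐ α⊆β k≤b
  }
  where
  from-A : ∀ x γ → ValidLvl n x → γ ∈ subsume a b α β keep db (D x) → InA n db γ
  from-A x γ x-valid γ∈ with ∈-subsume⁻ a b α β keep db γ∈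
  ... | inj₁ γ∈Dₓ       = InA-valid n db x-valid γ∈Dₓ
  ... | inj₂ (inj₁ refl) = InA-valid n db a-valid α∈Dₐ
  ... | inj₂ (inj₂ refl) = InA-valid n db b-valid β∈Dᵦ

lemma4 : (I : List Clause) → (∀ γ → γ ∈ I → IsClause γ) →
         (τ : Trail) → WFTrail I τ →
         (n : ℕ) → All (λ x → proj₂ x ≤ n) τ →
         (db : DB) → IsState n db → Invariants n db τ I →
         (a b : Lvl) → ValidLvl n a → ValidLvl n b →
         (α β : Clause) → α ∈ db (D a) → β ∈ db (D b) → α ≢ β →
         (k : ℕ) → RestrSub τ k α β → (∀ d → RestrSub τ d α β → k ≤ d) →
         k ≤L b →
         (keep : Bool) →
         Invariants n (subsume a b α β keep db) τ I
lemma4 I _ τ _ n _ db _ inv a b a-valid b-valid α β α∈Dₐ β∈Dᵦ α≢β k α⊆β _ k≤b keep =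
  ActiveRewrite-preserves-Invariants
    (subsume-ActiveRewrite a-valid b-valid α∈Dₐ β∈Dᵦ α≢β α⊆β k≤b keep) inv
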